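{- Let $n\ge 1$ and let $w$ be a word representing the complete graph $K_n$. If the length of $w$ is greater than $2n-1$, then $w$ contains at least one square.
   Context: A word $w$ over the alphabet $V$ represents the simple graph $G=(V,E)$ if every letter of $V$ occurs in $w$ and, for all distinct $x,y\in V$, $x$ and $y$ alternate in $w$ (deleting all other letters leaves $xyxy\cdots$ or $yxyx\cdots$) if and only if $xy\in E$. A square in a word is a factor of the form $XX$ with $X$ a non-empty word. -}

module Defs where

open import Data.Nat using (ℕ)
open import Data.Fin using (Fin)
open import Data.Fin.Properties using (_≟_)
open import Data.List using (List; []; filter; _++_)
open import Data.List.Membership.Propositional using (_∈_)
open import Data.List.Relation.Unary.Linked using (Linked)
open import Data.Product using (∃; _×_)
open import Data.Sum using (_⊎_)
open import Relation.Binary.PropositionalEquality using (_≡_; _≢_)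
open import Relation.Nullary.Decidable using (_⊎-dec_)

Word : ℕ → Set
Word n = List (Fin n)

restrict : ∀ {n} → Fin n → Fin n → Word n → Word n
restrict x y w = filter (λ z → (z ≟ x) ⊎-dec (z ≟ y)) w

-- x and y alternate in w: the restriction of w to {x,y} is xyxy... or yxyx...,
-- i.e. (since it only contains x and y) no two consecutive letters are equal.
Alternate : ∀ {n} → Word n → Fin n → Fin n → Set
Alternate w x y = Linked _≢_ (restrict x y w)

KEdge : ∀ {n} → Fin n → Fin n → Set
KEdge x y = x ≢ y

Represents : ∀ {n} → (Fin n → Fin n → Set) → Word n → Set
Represents {n} E w =
  ((x : Fin n) → x ∈ w) ×
  ((x y : Fin n) → x ≢ y → (Alternate w x y → E x y) × (E x y → Alternate w x y))

HasSquare : ∀ {n} → Word n → Set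
HasSquare {n} w = ∃ λ (u : Word n) → ∃ λ (X : Word n) → ∃ λ (v : Word n) →
  X ≢ [] × w ≡ u ++ (X ++ (X ++ v))

-- When every two letters alternate, all letters other than x occur between two occurrences of
-- x, so repeated letters are at least n apart; and a factor avoiding x has no repeated letter,
-- so it has at most n - 1 letters.  Hence the letter n places after an x is again x: the word
-- has period n, and having length at least 2n it begins with a square XX with |X| = n.
module Submission where

open import Defs
open import Data.Nat using (ℕ; _≥_; _>_; _∸_; _*_; suc; _+_; _≤_; s≤s; s≤s⁻¹)
open import Data.Nat.Properties
  using (≤-trans; m≤m+n; m+n≤o⇒m≤o∸n; m≤n⇒m⊓n≡m; +-comm; +-identityʳ; m+1+n≰m; 0≢1+n)
open import Data.Fin using (Fin; zero; suc)
open import Data.Fin.Properties using (_≟_; injective⇒≤)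
open import Data.List using (List; []; _∷_; _++_; [_]; length; lookup; take; drop)
open import Data.List.Properties
  using (++-assoc; ++-identityʳ; length-++; filter-++; filter-accept; length-take; length-drop; take++drop≡id)
open import Data.List.Membership.Propositional using (_∈_; _∉_)
open import Data.List.Membership.Propositional.Properties using (∈-∃++; ∈-++⁺ˡ; ∈-++⁻; ∈-filter⁻; ∈-lookup)
open import Data.List.Membership.Setoid.Properties using (index-injective)
open import Data.List.Relation.Unary.All using (All; []; _∷_)
import Data.List.Relation.Unary.All as All
open import Data.List.Relation.Unary.All.Properties using (¬Any⇒All¬; all-filter)
open import Data.List.Relation.Unary.Any using (here; there)
open import Data.List.Relation.Unary.Linked using (Linked; []; _∷_)
open import Data.List.Relation.Unary.Unique.Propositional using (Unique)
open import Data.List.Relation.Unary.AllPairs using ([]; _∷_)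
open import Data.Product using (∃; ∃₂; _×_; _,_; proj₁; proj₂)
open import Data.Sum using (_⊎_; inj₁; inj₂)
open import Data.Empty using (⊥-elim)
open import Function.Definitions using (Injective)
open import Relation.Nullary using (¬_; yes; no)
open import Relation.Nullary.Decidable using (_⊎-dec_)
open import Function.Base using (_∘_)
open import Relation.Binary.PropositionalEquality hiding ([_])

module _ {a} {A : Set a} where

  HasPeriod : ℕ → List A → Set a
  HasPeriod p w = ∀ u x m y v → w ≡ u ++ (x ∷ m) ++ y ∷ v → length (x ∷ m) ≡ p → x ≡ y

  periodic-factor-recurs : ∀ {p w} → HasPeriod p w → ∀ u X Z t →
    w ≡ u ++ X ++ Z ++ t → length (X ++ Z) ≡ p → length X ≤ length t → ∃ λ v → t ≡ X ++ v
  periodic-factor-recurs per u []      Z t       w≡ len le        = t , refl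
  periodic-factor-recurs {p} {w} per u (x ∷ X) Z (s ∷ t) w≡ len (s≤s le) with
    per u x (X ++ Z) s t (trans w≡ (cong (λ r → u ++ x ∷ r) (sym (++-assoc X Z (s ∷ t))))) len
  ... | refl = let v , t≡ = periodic-factor-recurs per (u ++ [ x ]) X (Z ++ [ x ]) t w≡′ len′ le
               in v , cong (x ∷_) t≡
    where
    w≡′ : w ≡ (u ++ [ x ]) ++ X ++ (Z ++ [ x ]) ++ t
    w≡′ = begin
      w                                  ≡⟨ w≡ ⟩
      u ++ [ x ] ++ X ++ Z ++ x ∷ t      ≡⟨ ++-assoc u [ x ] _ ⟨
      (u ++ [ x ]) ++ X ++ Z ++ x ∷ t    ≡⟨ cong (λ r → (u ++ [ x ]) ++ X ++ r) (++-assoc Z [ x ] t) ⟨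
      (u ++ [ x ]) ++ X ++ (Z ++ [ x ]) ++ t ∎
      where open ≡-Reasoning
    len′ : length (X ++ Z ++ [ x ]) ≡ p
    len′ = begin
      length (X ++ Z ++ [ x ])   ≡⟨ cong length (++-assoc X Z [ x ]) ⟨
      length ((X ++ Z) ++ [ x ]) ≡⟨ length-++ (X ++ Z) ⟩
      length (X ++ Z) + 1        ≡⟨ +-comm (length (X ++ Z)) 1 ⟩
      suc (length (X ++ Z))      ≡⟨ len ⟩
      p                          ∎
      where open ≡-Reasoning

  periodic⇒square-prefix : ∀ {p w} → HasPeriod p w → p + p ≤ length w →
    ∃₂ λ X v → length X ≡ p × w ≡ X ++ X ++ v
  periodic⇒square-prefix {p} {w} per 2p≤|w| =
    let v , t≡ = periodic-factor-recurs per [] X [] t w≡ |X++[]| |X|≤|t|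
    in X , v , |X| , trans w≡ (cong (X ++_) t≡)
    where
    X t : List A
    X = take p w
    t = drop p w
    w≡ : w ≡ X ++ t
    w≡ = sym (take++drop≡id p w)
    |X| : length X ≡ p
    |X| = trans (length-take p w) (m≤n⇒m⊓n≡m (≤-trans (m≤m+n p p) 2p≤|w|))
    |X++[]| : length (X ++ []) ≡ p
    |X++[]| = trans (cong length (++-identityʳ X)) |X|
    |X|≤|t| : length X ≤ length t
    |X|≤|t| = subst₂ _≤_ (sym |X|) (sym (length-drop p w)) (m+n≤o⇒m≤o∸n p 2p≤|w|)

  Unique⇒lookup-injective : ∀ {xs : List A} → Unique xs → Injective _≡_ _≡_ (lookup xs)
  Unique⇒lookup-injective {_ ∷ _} (x∉ ∷ u) {zero}  {zero}  eq = refl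
  Unique⇒lookup-injective {_ ∷ _} (x∉ ∷ u) {zero}  {suc j} eq = ⊥-elim (All.lookup x∉ (∈-lookup j) eq)
  Unique⇒lookup-injective {_ ∷ _} (x∉ ∷ u) {suc i} {zero}  eq = ⊥-elim (All.lookup x∉ (∈-lookup i) (sym eq))
  Unique⇒lookup-injective {_ ∷ _} (x∉ ∷ u) {suc i} {suc j} eq = cong suc (Unique⇒lookup-injective u eq)

Unique⇒length≤ : ∀ {n} {xs : List (Fin n)} → Unique xs → length xs ≤ n
Unique⇒length≤ u = injective⇒≤ (Unique⇒lookup-injective u)

covering⇒length≥ : ∀ {n} {xs : List (Fin n)} → (∀ x → x ∈ xs) → n ≤ length xs
covering⇒length≥ cover = injective⇒≤ λ {x} {y} → index-injective (setoid _) (cover x) (cover y)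

module _ {n : ℕ} where

  linked-++⁻ʳ : ∀ (xs ys : Word n) → Linked _≢_ (xs ++ ys) → Linked _≢_ ys
  linked-++⁻ʳ []           ys       l       = l
  linked-++⁻ʳ (x ∷ [])     []       l       = []
  linked-++⁻ʳ (x ∷ [])     (y ∷ ys) (_ ∷ l) = l
  linked-++⁻ʳ (x ∷ x′ ∷ xs) ys      (_ ∷ l) = linked-++⁻ʳ (x′ ∷ xs) ys l

  linked-∈-between : ∀ {x y : Fin n} r t → All (λ z → z ≡ x ⊎ z ≡ y) r →
    Linked _≢_ (x ∷ r ++ x ∷ t) → y ∈ r
  linked-∈-between []      t []               (x≢x ∷ _) = ⊥-elim (x≢x refl)
  linked-∈-between (z ∷ r) t (inj₁ refl ∷ _)  (x≢x ∷ _) = ⊥-elim (x≢x refl)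
  linked-∈-between (z ∷ r) t (inj₂ refl ∷ _)  _         = here refl

  restrict-head : ∀ (x y : Fin n) m → restrict x y (x ∷ m) ≡ x ∷ restrict x y m
  restrict-head x y m = filter-accept (λ z → (z ≟ x) ⊎-dec (z ≟ y)) (inj₁ refl)

  restrict-between : ∀ (x y : Fin n) u m v → restrict x y (u ++ x ∷ m ++ x ∷ v) ≡
    restrict x y u ++ x ∷ restrict x y m ++ x ∷ restrict x y v
  restrict-between x y u m v = begin
    restrict x y (u ++ x ∷ m ++ x ∷ v)
      ≡⟨ filter-++ _ u _ ⟩
    restrict x y u ++ restrict x y (x ∷ m ++ x ∷ v)
      ≡⟨ cong (restrict x y u ++_) (restrict-head x y _) ⟩
    restrict x y u ++ x ∷ restrict x y (m ++ x ∷ v)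
      ≡⟨ cong (λ r → restrict x y u ++ x ∷ r) (filter-++ _ m _) ⟩
    restrict x y u ++ x ∷ restrict x y m ++ restrict x y (x ∷ v)
      ≡⟨ cong (λ r → restrict x y u ++ x ∷ restrict x y m ++ r) (restrict-head x y v) ⟩
    restrict x y u ++ x ∷ restrict x y m ++ x ∷ restrict x y v
      ∎
    where open ≡-Reasoning

  alternate⇒∈-between : ∀ {x y : Fin n} {w} u m v →
    Alternate w x y → w ≡ u ++ x ∷ m ++ x ∷ v → y ∈ m
  alternate⇒∈-between {x} {y} u m v alt refl =
    proj₁ (∈-filter⁻ _ (linked-∈-between (restrict x y m) (restrict x y v) (all-filter _ m)
      (linked-++⁻ʳ (restrict x y u) _ (subst (Linked _≢_) (restrict-between x y u m v) alt))))

  PairwiseAlternating : Word n → Set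
  PairwiseAlternating w = ∀ x y → x ≢ y → Alternate w x y

  length-++-∷≰ : ∀ (xs ys : Word n) {z} → ¬ length (xs ++ z ∷ ys) ≤ length xs
  length-++-∷≰ xs ys = m+1+n≰m (length xs) ∘ subst (_≤ length xs) (length-++ xs)

  module _ {w : Word n} (alt : PairwiseAlternating w) where

    avoiding-factor-Unique : ∀ {a} u m v → w ≡ u ++ m ++ v → a ∉ m → Unique m
    avoiding-factor-Unique u []      v _  _ = []
    avoiding-factor-Unique {a} u (z ∷ m) v w≡ a∉ =
      ¬Any⇒All¬ m z∉m ∷
      avoiding-factor-Unique (u ++ [ z ]) m v (trans w≡ (sym (++-assoc u [ z ] (m ++ v)))) (a∉ ∘ there)
      where
      z≢a : z ≢ a
      z≢a refl = a∉ (here refl)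
      z∉m : z ∉ m
      z∉m z∈m with ∈-∃++ z∈m
      ... | m₁ , m₂ , refl = a∉ (there (∈-++⁺ˡ (alternate⇒∈-between u m₁ (m₂ ++ v) (alt z a z≢a)
              (trans w≡ (cong (λ r → u ++ z ∷ r) (++-assoc m₁ (z ∷ m₂) v))))))

    repeat-distance≥ : ∀ u x m v → w ≡ u ++ x ∷ m ++ x ∷ v → n ≤ length (x ∷ m)
    repeat-distance≥ u x m v w≡ = covering⇒length≥ covers
      where
      covers : ∀ z → z ∈ x ∷ m
      covers z with z ≟ x
      ... | yes refl = here refl
      ... | no  z≢x  = there (alternate⇒∈-between u m v (alt x z (z≢x ∘ sym)) w≡)

    pairwiseAlternating⇒period : HasPeriod n w
    pairwiseAlternating⇒period u x m y v w≡ |x∷m| with x ≟ y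
    ... | yes x≡y = x≡y
    ... | no  x≢y = ⊥-elim (length-++-∷≰ m [] (s≤s⁻¹ |x∷m++y|≤n))
      where
      x∉m : x ∉ m
      x∉m x∈m with ∈-∃++ x∈m
      ... | m₁ , m₂ , refl = length-++-∷≰ m₁ m₂ (s≤s⁻¹ (subst (_≤ suc (length m₁)) (sym |x∷m|)
              (repeat-distance≥ u x m₁ (m₂ ++ y ∷ v)
                (trans w≡ (cong (λ r → u ++ x ∷ r) (++-assoc m₁ (x ∷ m₂) (y ∷ v)))))))
      x∉m++y : x ∉ m ++ [ y ]
      x∉m++y x∈ with ∈-++⁻ m x∈
      ... | inj₁ x∈m        = x∉m x∈m
      ... | inj₂ (here x≡y) = x≢y x≡y
      w≡′ : w ≡ (u ++ [ x ]) ++ (m ++ [ y ]) ++ v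
      w≡′ = begin
        w                                 ≡⟨ w≡ ⟩
        u ++ [ x ] ++ m ++ [ y ] ++ v     ≡⟨ ++-assoc u [ x ] _ ⟨
        (u ++ [ x ]) ++ m ++ [ y ] ++ v   ≡⟨ cong ((u ++ [ x ]) ++_) (++-assoc m [ y ] v) ⟨
        (u ++ [ x ]) ++ (m ++ [ y ]) ++ v ∎
        where open ≡-Reasoning
      |x∷m++y|≤n : length (x ∷ m ++ [ y ]) ≤ length (x ∷ m)
      |x∷m++y|≤n = subst (length (x ∷ m ++ [ y ]) ≤_) (sym |x∷m|) (Unique⇒length≤
        (¬Any⇒All¬ _ x∉m++y ∷ avoiding-factor-Unique (u ++ [ x ]) (m ++ [ y ]) v w≡′ x∉m++y))

mainTheorem8 : (n : ℕ) → n ≥ 1 → (w : Word n) → Represents KEdge w →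
    length w > 2 * n ∸ 1 → HasSquare w
mainTheorem8 (suc k) _ w rep |w|> =
  let X , v , |X| , w≡ = periodic⇒square-prefix (pairwiseAlternating⇒period alt) 2n≤|w|
  in [] , X , v , (λ X≡[] → 0≢1+n (trans (cong length (sym X≡[])) |X|)) , w≡
  where
  alt : PairwiseAlternating w
  alt x y x≢y = proj₂ (proj₂ rep x y x≢y) x≢y
  2n≤|w| : suc k + suc k ≤ length w
  2n≤|w| = subst (_≤ length w) (cong (suc k +_) (+-identityʳ (suc k))) |w|>
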